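{- Let $F$ be an abelian group and $\gamma_1,\gamma_2,\gamma_3\in F$ with $\gamma_1\gamma_2=\gamma_3$, where $\gamma_1,\gamma_2$ have finite orders $m=|\gamma_1|$, $n=|\gamma_2|$. Suppose $r=|\gamma_3|$ is of the form $r=ps$ with $p$ a prime and $s$ a positive integer, and assume $v_p(m)\le v_p(n)$. Then $$n=\begin{cases} \dfrac{\gcd(n,s)}{\gcd(m,s)}\, m & \text{if } v_p(m)>v_p(s),\\[2mm] p\,\dfrac{\gcd(n,s)}{\gcd(m,s)}\, m & \text{if } v_p(m)\le v_p(s).\end{cases}$$
   Context: $|\gamma|$ denotes the order of $\gamma$. For a prime $p$ and a positive integer $x$, $v_p(x)$ is the $p$-adic valuation of $x$, i.e. the largest $k$ with $p^k\mid x$. -}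

module Defs where

open import Level using (Level)
open import Data.Nat using (ℕ; zero; suc; _+_; _*_; _^_; _<_; _≤_)
open import Data.Nat.Divisibility using (_∣_)
open import Relation.Nullary using (¬_)
open import Data.Product using (_×_)
open import Algebra.Bundles using (AbelianGroup)
import Algebra.Definitions.RawMonoid as RM

module _ {c ℓ : Level} (G : AbelianGroup c ℓ) where
  open AbelianGroup G

  pow : ℕ → Carrier → Carrier
  pow k x = RM._×_ rawMonoid k x

  HasOrder : Carrier → ℕ → Set ℓ
  HasOrder x m = (0 < m) × (pow m x ≈ ε) × (∀ k → 0 < k → k < m → ¬ (pow k x ≈ ε))

IsValuation : ℕ → ℕ → ℕ → Set
IsValuation p x k = (p ^ k ∣ x) × ¬ (p ^ suc k ∣ x)

-- Since γ₁γ₂ = γ₃ in an abelian group, each of m, n, r = ps divides every common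
-- multiple of the other two. Writing L(x) = lcm(x, s), and using that ps ∣ k iff
-- s ∣ k and p^(v_p(s)+1) ∣ k, this forces L(n) = L(m) when v_p(s) < v_p(m) ≤ v_p(n).
-- When v_p(m) ≤ v_p(s) we must have v_p(n) > v_p(s) (otherwise lcm(m, n), a multiple
-- of r, would have p-valuation at most v_p(s)); then L(m) ∣ L(n) ∣ p L(m), and
-- L(n) ≠ L(m) because p^(v_p(s)+1) divides L(n) but not L(m), so L(n) = p L(m).
-- Both cases turn into the stated formula through gcd(x, s) · lcm(x, s) = x s.
module Submission where

open import Defs
open import Level using (Level)
open import Data.Nat using (ℕ; zero; suc; _+_; _*_; _^_; _<_; _≤_; _∸_; NonZero; >-nonZero)
open import Data.Nat.Properties
open import Data.Nat.Divisibility
open import Data.Nat.DivMod using (_%_; _/_; m≡m%n+[m/n]*n; m%n<n)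
open import Data.Nat.GCD using (gcd)
open import Data.Nat.LCM using (lcm; m∣lcm[m,n]; n∣lcm[m,n]; lcm-least; gcd*lcm)
open import Data.Nat.Primality using (Prime; euclidsLemma; prime⇒nonZero; prime⇒irreducible)
open import Data.Product using (_×_; _,_; ∃-syntax)
open import Data.Sum using (_⊎_; inj₁; inj₂; [_,_]′)
open import Function using (_∘_; id)
open import Relation.Nullary using (¬_; contradiction)
open import Relation.Binary.PropositionalEquality using (_≡_; _≢_; refl; sym; trans; cong; subst; module ≡-Reasoning)
open import Algebra.Bundles using (AbelianGroup)
open import Data.Nat.Solver using (module +-*-Solver)
open +-*-Solver using (solve; _:*_; _:=_)

record DivisorTriangle (m n r : ℕ) : Set where
  field
    divides-r : ∀ {k} → m ∣ k → n ∣ k → r ∣ k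
    divides-n : ∀ {k} → m ∣ k → r ∣ k → n ∣ k
    divides-m : ∀ {k} → n ∣ k → r ∣ k → m ∣ k

module Order {c ℓ : Level} (F : AbelianGroup c ℓ) where
  open AbelianGroup F renaming (refl to ≈-refl; sym to ≈-sym; trans to ≈-trans)
  open import Algebra.Properties.CommutativeMonoid.Mult commutativeMonoid
    using (×-homo-+; ×-assocˡ; ×-distrib-+; ×-congʳ)
  open import Relation.Binary.Reasoning.Setoid setoid

  pow-ε : ∀ q → pow F q ε ≈ ε
  pow-ε zero    = ≈-refl
  pow-ε (suc q) = ≈-trans (identityˡ _) (pow-ε q)

  order∣⇒pow≈ε : ∀ {x m k} → HasOrder F x m → m ∣ k → pow F k x ≈ ε
  order∣⇒pow≈ε {x} {m} (_ , x^m≈ε , _) (divides q refl) = begin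
    pow F (q * m) x      ≈⟨ ×-assocˡ x q m ⟨
    pow F q (pow F m x)  ≈⟨ ×-congʳ q x^m≈ε ⟩
    pow F q ε            ≈⟨ pow-ε q ⟩
    ε                    ∎

  pow≈ε⇒order∣ : ∀ {x m k} → HasOrder F x m → pow F k x ≈ ε → m ∣ k
  pow≈ε⇒order∣ {x} {m} {k} order@(0<m , _ , minimal) x^k≈ε =
    m%n≡0⇒n∣m k m (n≤0⇒n≡0 (≮⇒≥ λ 0<k%m → minimal (k % m) 0<k%m (m%n<n k m) x^[k%m]≈ε))
    where
    instance
      m-nonZero : NonZero m
      m-nonZero = >-nonZero 0<m
    x^[k%m]≈ε : pow F (k % m) x ≈ ε
    x^[k%m]≈ε = begin
      pow F (k % m) x                            ≈⟨ identityʳ _ ⟨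
      pow F (k % m) x ∙ ε                        ≈⟨ ∙-congˡ (order∣⇒pow≈ε order (n∣m*n (k / m))) ⟨
      pow F (k % m) x ∙ pow F (k / m * m) x      ≈⟨ ×-homo-+ x (k % m) (k / m * m) ⟨
      pow F (k % m + k / m * m) x                ≡⟨ cong (λ j → pow F j x) (m≡m%n+[m/n]*n k m) ⟨
      pow F k x                                  ≈⟨ x^k≈ε ⟩
      ε                                          ∎

  pow-∙-cancelˡ : ∀ {x y z} k → x ∙ y ≈ z → pow F k x ≈ ε → pow F k z ≈ pow F k y
  pow-∙-cancelˡ {x} {y} {z} k xy≈z x^k≈ε = begin
    pow F k z                  ≈⟨ ×-congʳ k xy≈z ⟨
    pow F k (x ∙ y)            ≈⟨ ×-distrib-+ x y k ⟩
    pow F k x ∙ pow F k y      ≈⟨ ∙-congʳ x^k≈ε ⟩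
    ε ∙ pow F k y              ≈⟨ identityˡ _ ⟩
    pow F k y                  ∎

  orderTriangle : ∀ {γ₁ γ₂ γ₃ m n r} → γ₁ ∙ γ₂ ≈ γ₃ →
                  HasOrder F γ₁ m → HasOrder F γ₂ n → HasOrder F γ₃ r →
                  DivisorTriangle m n r
  orderTriangle {γ₁} {γ₂} γ₁γ₂≈γ₃ ord₁ ord₂ ord₃ = record
    { divides-r = λ {k} m∣k n∣k → pow≈ε⇒order∣ ord₃
        (≈-trans (pow-∙-cancelˡ k γ₁γ₂≈γ₃ (order∣⇒pow≈ε ord₁ m∣k)) (order∣⇒pow≈ε ord₂ n∣k))
    ; divides-n = λ {k} m∣k r∣k → pow≈ε⇒order∣ ord₂
        (≈-trans (≈-sym (pow-∙-cancelˡ k γ₁γ₂≈γ₃ (order∣⇒pow≈ε ord₁ m∣k))) (order∣⇒pow≈ε ord₃ r∣k))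
    ; divides-m = λ {k} n∣k r∣k → pow≈ε⇒order∣ ord₁
        (≈-trans (≈-sym (pow-∙-cancelˡ k (≈-trans (comm γ₂ γ₁) γ₁γ₂≈γ₃) (order∣⇒pow≈ε ord₂ n∣k)))
                 (order∣⇒pow≈ε ord₃ r∣k))
    }

p^m∣p^n : ∀ p {m n} → m ≤ n → p ^ m ∣ p ^ n
p^m∣p^n p {m} {n} m≤n = divides (p ^ (n ∸ m)) (begin
  p ^ n                  ≡⟨ cong (p ^_) (m+[n∸m]≡n m≤n) ⟨
  p ^ (m + (n ∸ m))      ≡⟨ ^-distribˡ-+-* p m (n ∸ m) ⟩
  p ^ m * p ^ (n ∸ m)    ≡⟨ *-comm (p ^ m) (p ^ (n ∸ m)) ⟩
  p ^ (n ∸ m) * p ^ m    ∎)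
  where open ≡-Reasoning

∣∧∣p*⇒≡∨≡p* : ∀ {p a b} → Prime p → a ∣ b → b ∣ p * a → b ≡ a ⊎ b ≡ p * a
∣∧∣p*⇒≡∨≡p* {a = zero} _ (divides d refl) _ = inj₁ (*-zeroʳ d)
∣∧∣p*⇒≡∨≡p* {p} {a@(suc _)} p-prime (divides d refl) (divides e pa≡e*[d*a])
  with prime⇒irreducible p-prime (divides e (*-cancelʳ-≡ p (e * d) a
         (trans pa≡e*[d*a] (sym (*-assoc e d a)))))
... | inj₁ refl = inj₁ (*-identityˡ a)
... | inj₂ refl = inj₂ refl

lcm[n,s]≡c*lcm[m,s]⇒n*gcd[m,s]≡c*[gcd[n,s]*m] :
  ∀ m n s c .{{_ : NonZero s}} → lcm n s ≡ c * lcm m s → n * gcd m s ≡ c * (gcd n s * m)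
lcm[n,s]≡c*lcm[m,s]⇒n*gcd[m,s]≡c*[gcd[n,s]*m] m n s c Ln≡c*Lm = *-cancelʳ-≡ _ _ s (begin
  n * gm * s             ≡⟨ solve 3 (λ n gm s → n :* gm :* s := gm :* (n :* s)) refl n gm s ⟩
  gm * (n * s)           ≡⟨ cong (gm *_) (gcd*lcm n s) ⟨
  gm * (gn * lcm n s)    ≡⟨ cong (λ l → gm * (gn * l)) Ln≡c*Lm ⟩
  gm * (gn * (c * Lm))   ≡⟨ solve 4 (λ gm gn c l → gm :* (gn :* (c :* l)) := c :* gn :* (gm :* l))
                                    refl gm gn c Lm ⟩
  c * gn * (gm * Lm)     ≡⟨ cong (c * gn *_) (gcd*lcm m s) ⟩
  c * gn * (m * s)       ≡⟨ solve 4 (λ c gn m s → c :* gn :* (m :* s) := c :* (gn :* m) :* s)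
                                    refl c gn m s ⟩
  c * (gn * m) * s       ∎)
  where
  open ≡-Reasoning
  gm = gcd m s
  gn = gcd n s
  Lm = lcm m s

module Valuation {p : ℕ} (p-prime : Prime p) where
  private instance
    p-nonZero : NonZero p
    p-nonZero = prime⇒nonZero p-prime

  valuation⇒p^w∣ : ∀ {x v w} → IsValuation p x v → w ≤ v → p ^ w ∣ x
  valuation⇒p^w∣ (p^v∣x , _) w≤v = ∣-trans (p^m∣p^n p w≤v) p^v∣x

  valuation-cofactor : ∀ {x v} → IsValuation p x v → ∃[ y ] x ≡ y * p ^ v × ¬ p ∣ y
  valuation-cofactor {v = v} (divides y x≡y*p^v , p^suc∤x) = y , x≡y*p^v , λ p∣y →
    p^suc∤x (subst (p * p ^ v ∣_) (sym x≡y*p^v) (*-monoˡ-∣ (p ^ v) p∣y))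

  p^a∣m*n⇒p^a∣n : ∀ {m} → ¬ p ∣ m → ∀ a {n} → p ^ a ∣ m * n → p ^ a ∣ n
  p^a∣m*n⇒p^a∣n _ zero {n} _ = 1∣ n
  p^a∣m*n⇒p^a∣n {m} p∤m (suc a) {n} p^suc∣m*n
    with euclidsLemma m n p-prime (m*n∣⇒m∣ p (p ^ a) p^suc∣m*n)
  ... | inj₁ p∣m = contradiction p∣m p∤m
  ... | inj₂ (divides q refl) =
    subst (_∣ q * p) (*-comm (p ^ a) p) (*-monoˡ-∣ p (p^a∣m*n⇒p^a∣n p∤m a p^a∣m*q))
    where
    p^a∣m*q : p ^ a ∣ m * q
    p^a∣m*q = *-cancelˡ-∣ p (subst (p * p ^ a ∣_)
                (trans (sym (*-assoc m q p)) (*-comm (m * q) p)) p^suc∣m*n)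

  p^a∣∧m∣⇒p^a*m∣ : ∀ {a m n} → ¬ p ∣ m → p ^ a ∣ n → m ∣ n → p ^ a * m ∣ n
  p^a∣∧m∣⇒p^a*m∣ {a} {m} p∤m p^a∣n (divides q refl) =
    *-monoˡ-∣ m (p^a∣m*n⇒p^a∣n p∤m a (subst (p ^ a ∣_) (*-comm q m) p^a∣n))

  data ValuationAtMost (x v : ℕ) : Set where
    atMost : ∀ y → ¬ p ∣ y → x ∣ p ^ v * y → ValuationAtMost x v

  valuation⇒atMost : ∀ {x v w} → IsValuation p x v → v ≤ w → ValuationAtMost x w
  valuation⇒atMost {x} {v} {w} val v≤w with valuation-cofactor {x} {v} val
  ... | y , refl , p∤y =
    atMost y p∤y (subst (_∣ p ^ w * y) (*-comm (p ^ v) y) (*-monoˡ-∣ y (p^m∣p^n p v≤w)))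

  atMost-lcm : ∀ {x z v} → ValuationAtMost x v → ValuationAtMost z v → ValuationAtMost (lcm x z) v
  atMost-lcm {v = v} (atMost y p∤y x∣p^v*y) (atMost y′ p∤y′ z∣p^v*y′) =
    atMost (y * y′) ([ p∤y , p∤y′ ]′ ∘ euclidsLemma y y′ p-prime)
      (lcm-least (∣-trans x∣p^v*y (*-monoʳ-∣ (p ^ v) (m∣m*n y′)))
                 (∣-trans z∣p^v*y′ (*-monoʳ-∣ (p ^ v) (n∣m*n y))))

  atMost⇒p^suc∤ : ∀ {x v} → ValuationAtMost x v → ¬ p ^ suc v ∣ x
  atMost⇒p^suc∤ {v = v} (atMost y p∤y x∣p^v*y) p^suc∣x =
    p∤y (*-cancelˡ-∣ (p ^ v) {{m^n≢0 p v}}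
      (subst (_∣ p ^ v * y) (*-comm p (p ^ v)) (∣-trans p^suc∣x x∣p^v*y)))

  module _ {s vs : ℕ} (vals : IsValuation p s vs) where

    p^suc∣∧s∣⇒p*s∣ : ∀ {k} → p ^ suc vs ∣ k → s ∣ k → p * s ∣ k
    p^suc∣∧s∣⇒p*s∣ {k} p^suc∣k s∣k with valuation-cofactor {s} {vs} vals
    ... | t , refl , p∤t =
      subst (_∣ k) (trans (*-assoc p (p ^ vs) t) (cong (p *_) (*-comm (p ^ vs) t)))
            (p^a∣∧m∣⇒p^a*m∣ {suc vs} p∤t p^suc∣k (∣-trans (m∣m*n (p ^ vs)) s∣k))

    p*s∣⇒p^suc∣ : ∀ {k} → p * s ∣ k → p ^ suc vs ∣ k
    p*s∣⇒p^suc∣ = ∣-trans (*-monoʳ-∣ p (valuation⇒p^w∣ vals (≤-refl {vs})))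

    lcm[y,s]∣lcm[x,s] : ∀ {x y vx} → IsValuation p x vx → vs < vx →
                        (∀ {k} → x ∣ k → p * s ∣ k → y ∣ k) → lcm y s ∣ lcm x s
    lcm[y,s]∣lcm[x,s] {x} valx vs<vx y∣ = lcm-least (y∣ x∣Lx r∣Lx) (n∣lcm[m,n] x s)
      where
      x∣Lx : x ∣ lcm x s
      x∣Lx = m∣lcm[m,n] x s
      r∣Lx : p * s ∣ lcm x s
      r∣Lx = p^suc∣∧s∣⇒p*s∣ (∣-trans (valuation⇒p^w∣ valx vs<vx) x∣Lx) (n∣lcm[m,n] x s)

    module _ {m n vm vn : ℕ} (T : DivisorTriangle m n (p * s))
             (valm : IsValuation p m vm) (valn : IsValuation p n vn) where
      open DivisorTriangle T

      lcm[n,s]≡lcm[m,s] : vs < vm → vm ≤ vn → lcm n s ≡ lcm m s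
      lcm[n,s]≡lcm[m,s] vs<vm vm≤vn = ∣-antisym
        (lcm[y,s]∣lcm[x,s] valm vs<vm divides-n)
        (lcm[y,s]∣lcm[x,s] valn (<-≤-trans vs<vm vm≤vn) divides-m)

      lcm[n,s]≡p*lcm[m,s] : vm ≤ vs → lcm n s ≡ p * lcm m s
      lcm[n,s]≡p*lcm[m,s] vm≤vs =
        [ (λ Ln≡Lm → contradiction Ln≡Lm Ln≢Lm) , id ]′ (∣∧∣p*⇒≡∨≡p* p-prime Lm∣Ln Ln∣p*Lm)
        where
        vs<vn : vs < vn
        vs<vn = ≰⇒> λ vn≤vs →
          atMost⇒p^suc∤ (atMost-lcm (valuation⇒atMost valm vm≤vs) (valuation⇒atMost valn vn≤vs))
                        (p*s∣⇒p^suc∣ (divides-r (m∣lcm[m,n] m n) (n∣lcm[m,n] m n)))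
        p^suc∣Ln : p ^ suc vs ∣ lcm n s
        p^suc∣Ln = ∣-trans (valuation⇒p^w∣ valn vs<vn) (m∣lcm[m,n] n s)
        Lm∣Ln : lcm m s ∣ lcm n s
        Lm∣Ln = lcm[y,s]∣lcm[x,s] valn vs<vn divides-m
        Ln≢Lm : lcm n s ≢ lcm m s
        Ln≢Lm Ln≡Lm =
          atMost⇒p^suc∤ (atMost-lcm (valuation⇒atMost valm vm≤vs) (valuation⇒atMost vals ≤-refl))
                        (subst (p ^ suc vs ∣_) Ln≡Lm p^suc∣Ln)
        Ln∣p*Lm : lcm n s ∣ p * lcm m s
        Ln∣p*Lm = lcm-least (divides-n (∣n⇒∣m*n p (m∣lcm[m,n] m s)) (*-monoʳ-∣ p (n∣lcm[m,n] m s)))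
                            (∣n⇒∣m*n p (n∣lcm[m,n] m s))

mainTheorem5 : {c ℓ : Level} (F : AbelianGroup c ℓ) →
    let open AbelianGroup F in
    (γ₁ γ₂ γ₃ : Carrier) (m n r p s : ℕ) →
    γ₁ ∙ γ₂ ≈ γ₃ →
    HasOrder F γ₁ m → HasOrder F γ₂ n → HasOrder F γ₃ r →
    Prime p → 0 < s → r ≡ p * s →
    (vm vn vs : ℕ) → IsValuation p m vm → IsValuation p n vn → IsValuation p s vs →
    vm ≤ vn →
    (vs < vm → n * gcd m s ≡ gcd n s * m) ×
    (vm ≤ vs → n * gcd m s ≡ p * (gcd n s * m))
mainTheorem5 F γ₁ γ₂ γ₃ m n r p s γ₁γ₂≈γ₃ ord₁ ord₂ ord₃ p-prime 0<s refl
             vm vn vs valm valn vals vm≤vn =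
  (λ vs<vm → trans (gcd-form 1 (trans (lcm[n,s]≡lcm[m,s] vals triangle valm valn vs<vm vm≤vn)
                                      (sym (*-identityˡ _))))
                   (*-identityˡ _)) ,
  (λ vm≤vs → gcd-form p (lcm[n,s]≡p*lcm[m,s] vals {vn = vn} triangle valm valn vm≤vs))
  where
  open Valuation p-prime
  instance
    s-nonZero : NonZero s
    s-nonZero = >-nonZero 0<s
  triangle : DivisorTriangle m n (p * s)
  triangle = Order.orderTriangle F γ₁γ₂≈γ₃ ord₁ ord₂ ord₃
  gcd-form : ∀ c → lcm n s ≡ c * lcm m s → n * gcd m s ≡ c * (gcd n s * m)
  gcd-form c = lcm[n,s]≡c*lcm[m,s]⇒n*gcd[m,s]≡c*[gcd[n,s]*m] m n s c
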